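{- Identify each board with its indicator function $f:e(\mathbb{Z}^2)\to\{0,1\}$, where $e(\mathbb{Z}^2)$ is the edge set of $\mathbb{Z}^2$, and equip the set of boards with the product topology (a compact metrizable space). Let $\mathcal{A}_1,\mathcal{A}_2$ be two sets of mazes with the following properties: (1) for all $i\in\{1,2\}$, all $o,d\in\mathbb{Z}^2$ and all paths $P$ in $\mathbb{Z}^2$ between $o$ and $d$, the set of boards $B_i=\{M : (M,o,d)\in\mathcal{A}_i,\ P\subseteq M\}$ is compact; (2) for all $i\in\{1,2\}$, if $(M,o,d)\in\mathcal{A}_i$ then $(M,o',d')\in\mathcal{A}_i$ for all vertices $o',d'$ in the same connected component of $M$ as $o,d$; (3) there exist algorithms $A_1$ and $A_2$ that solve $\mathcal{A}_1$ and $\mathcal{A}_2$, respectively. Then there exists an algorithm $A$ that solves $\mathcal{A}=\mathcal{A}_1\cup\mathcal{A}_2$ and such that, for every maze in $\mathcal{A}$, the robot following $A$ visits the destination infinitely often. Moreover, any algorithm obtained from $A$ by deleting a finite initial segment or by prepending a finite algorithm has the same property.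
   Context: A board is a spanning subgraph $M$ of the graph $\mathbb{Z}^2$; each edge is traversable in both directions, and the directed edge from $(x,y)$ to $(x,y+1)$, $(x,y-1)$, $(x+1,y)$, $(x-1,y)$ has colour $N$, $S$, $E$, $W$ respectively. A maze is a triple $(M,o,d)$ with $M$ a board and $o$ (origin), $d$ (destination) vertices in the same connected component of $M$. An algorithm is a finite or infinite sequence of instructions from $\{N,S,E,W\}$. A robot at vertex $v$ executing instruction $I$ moves along the edge of colour $I$ leaving $v$ if it is present in $M$, and otherwise stays at $v$. The robot starts at $o$ and executes the instructions in order; the algorithm solves the maze if the robot visits $d$ at some time, and solves a set of mazes if it solves each of them. -}

module Defs where

open import Data.Nat using (ℕ; zero; suc; _≤_)
open import Data.Integer using (ℤ; _+_; _-_; 0ℤ; 1ℤ)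
open import Data.Bool using (Bool; true; false; if_then_else_)
open import Data.Product using (Σ; ∃; _×_; _,_)
open import Data.List using (List; []; _∷_; _++_)
open import Data.List.Relation.Unary.All using (All)
open import Data.List.Relation.Unary.Unique.Propositional using (Unique)
open import Data.List.Membership.Propositional using (_∈_)
open import Relation.Binary.PropositionalEquality using (_≡_)

V : Set
V = ℤ × ℤ

-- An edge of ℤ² is named by its lower/left endpoint and its axis:
-- (v , horiz) is the edge {v, v+(1,0)}; (v , vert) is {v, v+(0,1)}.
data Axis : Set where
  horiz vert : Axis

Edge : Set
Edge = V × Axis

Board : Set
Board = Edge → Bool

data Dir : Set where
  N S E W : Dir

nbr : V → Dir → V
nbr (x , y) N = (x , y + 1ℤ)
nbr (x , y) S = (x , y - 1ℤ)
nbr (x , y) E = (x + 1ℤ , y)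
nbr (x , y) W = (x - 1ℤ , y)

edgeAt : V → Dir → Edge
edgeAt v N = (v , vert)
edgeAt v S = (nbr v S , vert)
edgeAt v E = (v , horiz)
edgeAt v W = (nbr v W , horiz)

data Reach (M : Board) : V → V → Set where
  here : ∀ {v} → Reach M v v
  step : ∀ {v w} (I : Dir) → M (edgeAt v I) ≡ true → Reach M (nbr v I) w → Reach M v w

walkVerts : V → List Dir → List V
walkVerts v [] = v ∷ []
walkVerts v (I ∷ ds) = v ∷ walkVerts (nbr v I) ds

walkEnd : V → List Dir → V
walkEnd v [] = v
walkEnd v (I ∷ ds) = walkEnd (nbr v I) ds

walkEdges : V → List Dir → List Edge
walkEdges v [] = []
walkEdges v (I ∷ ds) = edgeAt v I ∷ walkEdges (nbr v I) ds

IsPath : V → V → List Dir → Set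
IsPath o d ds = Unique (walkVerts o ds) × walkEnd o ds ≡ d

PathIn : Board → V → List Dir → Set
PathIn M o ds = All (λ e → M e ≡ true) (walkEdges o ds)

-- Product topology on boards: U is open iff every member has a basic
-- cylinder neighbourhood (determined by finitely many edges) inside U.
IsOpen : (Board → Set) → Set
IsOpen U = ∀ M → U M →
  Σ (List Edge) λ F → ∀ M' → (∀ e → e ∈ F → M' e ≡ M e) → U M'

IsCompact : (Board → Set) → Set₁
IsCompact K = (I : Set) (U : I → Board → Set) →
  (∀ i → IsOpen (U i)) →
  (∀ M → K M → Σ I λ i → U i M) →
  Σ (List I) λ is → ∀ M → K M → Σ I λ i → i ∈ is × U i M

MazeSet : Set₁
MazeSet = Board → V → V → Set

IsMazeSet : MazeSet → Set
IsMazeSet 𝒜 = ∀ M o d → 𝒜 M o d → Reach M o d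

_∪_ : MazeSet → MazeSet → MazeSet
(𝒜 ∪ ℬ) M o d = Data.Sum._⊎_ (𝒜 M o d) (ℬ M o d)
  where import Data.Sum

move : Board → V → Dir → V
move M v I = if M (edgeAt v I) then nbr v I else v

data Algorithm : Set where
  finite   : List Dir → Algorithm
  infinite : (ℕ → Dir) → Algorithm

posL : Board → V → List Dir → V
posL M v [] = v
posL M v (I ∷ ds) = posL M (move M v I) ds

posS : Board → V → (ℕ → Dir) → ℕ → V
posS M v A zero = v
posS M v A (suc n) = move M (posS M v A n) (A n)

data VisitsL (M : Board) (d : V) : V → List Dir → Set where
  now   : ∀ {ds} → VisitsL M d d ds
  later : ∀ {v I ds} → VisitsL M d (move M v I) ds → VisitsL M d v (I ∷ ds)

Solves : Algorithm → Board → V → V → Set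
Solves (finite ds) M o d = VisitsL M d o ds
Solves (infinite A) M o d = Σ ℕ λ t → posS M o A t ≡ d

SolvesSet : Algorithm → MazeSet → Set
SolvesSet A 𝒜 = ∀ M o d → 𝒜 M o d → Solves A M o d

dropS : ℕ → (ℕ → Dir) → (ℕ → Dir)
dropS k A n = A (k Data.Nat.+ n)
  where import Data.Nat

prependS : List Dir → (ℕ → Dir) → (ℕ → Dir)
prependS [] A n = A n
prependS (I ∷ ds) A zero = I
prependS (I ∷ ds) A (suc n) = prependS ds A n

InfOften : (ℕ → Dir) → Board → V → V → Set
InfOften A M o d = ∀ n → Σ ℕ λ t → n ≤ t × posS M o A t ≡ d

SolvesInfOften : (ℕ → Dir) → MazeSet → Set
SolvesInfOften A 𝒜 = ∀ M o d → 𝒜 M o d → InfOften A M o d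

-- Compactness turns a solver of 𝒜 into uniform finite solutions: given an origin o, a walk P and a
-- prefix u already executed, the mazes of 𝒜 from o to the end of P containing (the loop erasure of) P
-- form a compact set, covered by the open sets "the solver, started where u left the robot, arrives
-- within T steps" (relocation closure lets it start anywhere); a finite subcover bounds T, so a single
-- finite word serves all these mazes. Enumerate all tasks (i, o, P, k, n) and, for each in turn,
-- extend the current finite algorithm by padding and then the uniform word for 𝒜ᵢ after the prefix
-- that the robot following the k-shifted algorithm has already run. The limit meets every task, so
-- each shift of it visits every destination at arbitrarily late times; prepending L is the same as
-- starting from the position reached after L, which relocation closure again allows.
module Submission where

open import Defs
open import Data.Nat using (ℕ; zero; suc; _+_; _∸_; _≤_; _<_; _≤′_; ≤′-refl; ≤′-step; z≤n; s≤s; s<s⁻¹)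
open import Data.Nat.Properties
  using (≤-refl; ≤-trans; ≤-total; m≤m+n; m≤n+m; +-suc; +-identityʳ; ∸-monoˡ-≤; m+n∸m≡n; ≤⇒≤′; module ≤-Reasoning)
open import Data.Integer as ℤ using (ℤ; +_; -[1+_]; _⊖_)
open import Data.Bool using (Bool; true; false; if_then_else_)
open import Data.Fin using (fromℕ<)
open import Data.List using (List; []; _∷_; _++_; length; drop; replicate; applyUpTo; lookup)
open import Data.List.Properties
  using (∷-injectiveˡ; ∷-injectiveʳ; ++-assoc; applyUpTo-∷ʳ; ++-identityʳ; length-++; length-drop; length-replicate)
open import Data.List.Relation.Unary.All as All using ([]; _∷_)
open import Data.List.Relation.Unary.All.Properties using (anti-mono; ¬Any⇒All¬)
open import Data.List.Relation.Unary.AllPairs using ([]; _∷_)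
open import Data.List.Relation.Unary.Any using (here; there)
open import Data.List.Relation.Unary.Unique.Propositional using (Unique)
open import Data.List.Relation.Binary.Subset.Propositional using (_⊆_)
open import Data.List.Relation.Binary.Subset.Propositional.Properties using (∷⁺ʳ)
open import Data.List.Membership.Propositional using (_∈_)
open import Data.List.Extrema.Nat using (max; xs≤max)
open import Data.Product using (Σ; _×_; _,_; proj₁; proj₂; uncurry)
open import Data.Product.Properties using (≡-dec)
open import Data.List.Membership.DecPropositional (≡-dec ℤ._≟_ ℤ._≟_) using (_∈?_)
open import Data.Product.Function.NonDependent.Propositional using (_×-↠_)
open import Data.Sum using (inj₁; inj₂)
open import Function using (_∘_; _∘₂_; id)
open import Function.Bundles using (_↠_; mk↠ₛ; Surjection)
open import Function.Construct.Composition using (_↠-∘_)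
open import Function.Construct.Identity using (↠-id)
open import Relation.Nullary using (yes; no)
open import Relation.Binary.PropositionalEquality
  using (_≡_; refl; sym; trans; cong; cong₂; subst; module ≡-Reasoning)

open Surjection using (to; strictlySurjective)

private
  variable
    A : Set

posL-++ : ∀ M v xs ys → posL M v (xs ++ ys) ≡ posL M (posL M v xs) ys
posL-++ M v []       ys = refl
posL-++ M v (I ∷ xs) ys = posL-++ M (move M v I) xs ys

posS≡posL-applyUpTo : ∀ M v f t → posS M v f t ≡ posL M v (applyUpTo f t)
posS≡posL-applyUpTo M v f zero    = refl
posS≡posL-applyUpTo M v f (suc t) = begin
  move M (posS M v f t) (f t)                  ≡⟨ cong (λ w → move M w (f t)) (posS≡posL-applyUpTo M v f t) ⟩
  posL M (posL M v (applyUpTo f t)) (f t ∷ []) ≡⟨ posL-++ M v (applyUpTo f t) (f t ∷ []) ⟨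
  posL M v (applyUpTo f t ++ f t ∷ [])         ≡⟨ cong (posL M v) (applyUpTo-∷ʳ f t) ⟩
  posL M v (applyUpTo f (suc t))               ∎
  where open ≡-Reasoning

reach-trans : ∀ {M u v w} → Reach M u v → Reach M v w → Reach M u w
reach-trans here            r = r
reach-trans (step I e r) r′ = step I e (reach-trans r r′)

reach-move : ∀ M v I → Reach M v (move M v I)
reach-move M v I with M (edgeAt v I) in e
... | true  = step I e here
... | false = here

reach-posL : ∀ M v xs → Reach M v (posL M v xs)
reach-posL M v []       = here
reach-posL M v (I ∷ xs) = reach-trans (reach-move M v I) (reach-posL M (move M v I) xs)

visits⇒prefix : ∀ {M d v xs} → VisitsL M d v xs →
  Σ (List Dir) λ ys → Σ (List Dir) λ zs → xs ≡ ys ++ zs × posL M v ys ≡ d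
visits⇒prefix {xs = xs} now = [] , xs , refl , refl
visits⇒prefix {xs = I ∷ xs} (later vis) with visits⇒prefix vis
... | ys , zs , refl , e = I ∷ ys , zs , refl , e

visits-applyUpTo : ∀ {M d v} g {t T} → t ≤ T → posL M v (applyUpTo g t) ≡ d →
  VisitsL M d v (applyUpTo g T)
visits-applyUpTo g z≤n       refl = now
visits-applyUpTo g (s≤s t≤T) e    = later (visits-applyUpTo (g ∘ suc) t≤T e)

queried : Board → V → List Dir → List Edge
queried M v []       = []
queried M v (I ∷ xs) = edgeAt v I ∷ queried M (move M v I) xs

posL-local : ∀ M M′ v xs → (∀ e → e ∈ queried M v xs → M′ e ≡ M e) → posL M′ v xs ≡ posL M v xs
posL-local M M′ v []       agree = refl
posL-local M M′ v (I ∷ xs) agree rewrite agree (edgeAt v I) (here refl) =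
  posL-local M M′ (move M v I) xs (λ e → agree e ∘ there)

posL≡-isOpen : ∀ v xs d → IsOpen (λ M → posL M v xs ≡ d)
posL≡-isOpen v xs d M reached = queried M v xs , λ M′ agree → trans (posL-local M M′ v xs agree) reached

-- Walks and loop erasure

reach⇒walk : ∀ {M o d} → Reach M o d → Σ (List Dir) λ P → walkEnd o P ≡ d × PathIn M o P
reach⇒walk here = [] , refl , []
reach⇒walk (step I e r) with reach⇒walk r
... | P , end , P⊆M = I ∷ P , end , e ∷ P⊆M

walk-suffix : ∀ {v} w Q → v ∈ walkVerts w Q → Σ (List Dir) λ R →
  walkEnd v R ≡ walkEnd w Q × (Unique (walkVerts w Q) → Unique (walkVerts v R)) × walkEdges v R ⊆ walkEdges w Q
walk-suffix w []      (here refl) = [] , refl , id , λ ()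
walk-suffix w (I ∷ Q) (here refl) = I ∷ Q , refl , id , id
walk-suffix w (I ∷ Q) (there v∈) with walk-suffix (nbr w I) Q v∈
... | R , end , unique , R⊆Q = R , end , (λ { (_ ∷ u) → unique u }) , there ∘ R⊆Q

loopErase : ∀ o P → Σ (List Dir) λ Q → IsPath o (walkEnd o P) Q × walkEdges o Q ⊆ walkEdges o P
loopErase o []      = [] , ([] ∷ [] , refl) , id
loopErase o (I ∷ P) with loopErase (nbr o I) P
... | Q , (unique , end) , Q⊆P with o ∈? walkVerts (nbr o I) Q
...   | no o∉Q = I ∷ Q , (¬Any⇒All¬ _ o∉Q ∷ unique , end) , ∷⁺ʳ _ Q⊆P
...   | yes o∈Q with walk-suffix (nbr o I) Q o∈Q
...     | R , end′ , unique′ , R⊆Q = R , (unique′ unique , trans end′ end) , there ∘ Q⊆P ∘ R⊆Q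

private
  next-on-diagonal : ℕ × ℕ → ℕ × ℕ
  next-on-diagonal (a , zero)  = 0 , suc a
  next-on-diagonal (a , suc b) = suc a , b

unpair : ℕ → ℕ × ℕ
unpair zero    = 0 , 0
unpair (suc m) = next-on-diagonal (unpair m)

private
  Hit : ℕ × ℕ → Set
  Hit p = Σ ℕ λ m → unpair m ≡ p

  hit-next : ∀ {p} → Hit p → Hit (next-on-diagonal p)
  hit-next (m , e) = suc m , cong next-on-diagonal e

  hit-antidiagonal : ∀ a b → Hit (0 , a + b) → Hit (a , b)
  hit-antidiagonal zero    b hit = hit
  hit-antidiagonal (suc a) b hit =
    hit-next (hit-antidiagonal a (suc b) (subst (Hit ∘ (0 ,_)) (sym (+-suc a b)) hit))

  hit-axis : ∀ c → Hit (0 , c)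
  hit-axis zero    = 0 , refl
  hit-axis (suc c) = hit-next (hit-antidiagonal c 0 (subst (Hit ∘ (0 ,_)) (sym (+-identityʳ c)) (hit-axis c)))

ℕ↠ℕ×ℕ : ℕ ↠ (ℕ × ℕ)
ℕ↠ℕ×ℕ = mk↠ₛ {to = unpair} λ (a , b) → hit-antidiagonal a b (hit-axis (a + b))

infixr 4 _⊗_
_⊗_ : {B C : Set} → ℕ ↠ B → ℕ ↠ C → ℕ ↠ (B × C)
e₁ ⊗ e₂ = (e₁ ×-↠ e₂) ↠-∘ ℕ↠ℕ×ℕ

ℕ↠ℤ : ℕ ↠ ℤ
ℕ↠ℤ = mk↠ₛ {to = uncurry _⊖_} (λ { (+ n) → (n , 0) , refl ; -[1+ n ] → (0 , suc n) , refl }) ↠-∘ ℕ↠ℕ×ℕ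

ℕ↠Bool : ℕ ↠ Bool
ℕ↠Bool = mk↠ₛ {to = λ { zero → true ; (suc _) → false }} λ { true → 0 , refl ; false → 1 , refl }

ℕ↠Dir : ℕ ↠ Dir
ℕ↠Dir = mk↠ₛ {to = λ { 0 → N ; 1 → S ; 2 → E ; _ → W }} λ { N → 0 , refl ; S → 1 , refl ; E → 2 , refl ; W → 3 , refl }

module _ (e : ℕ ↠ A) where

  decodeList : ℕ → ℕ → List A
  decodeList zero    c = []
  decodeList (suc n) c = to e (proj₁ (unpair c)) ∷ decodeList n (proj₂ (unpair c))

  decodeList-surjective : ∀ xs → Σ ℕ λ c → decodeList (length xs) c ≡ xs
  decodeList-surjective []       = 0 , refl
  decodeList-surjective (x ∷ xs) with strictlySurjective e x | decodeList-surjective xs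
  ... | a , refl | c , decode with strictlySurjective ℕ↠ℕ×ℕ (a , c)
  ... | m , refl = m , cong (to e a ∷_) decode

  ℕ↠List : ℕ ↠ List A
  ℕ↠List = mk↠ₛ {to = uncurry decodeList}
             (λ xs → let (c , decode) = decodeList-surjective xs in (length xs , c) , decode)
           ↠-∘ ℕ↠ℕ×ℕ

infix 4 _⊑_
_⊑_ : List A → (ℕ → A) → Set
xs ⊑ f = applyUpTo f (length xs) ≡ xs

⊑-++⁻ˡ : ∀ {f : ℕ → A} xs {ys} → xs ++ ys ⊑ f → xs ⊑ f
⊑-++⁻ˡ []       prefix = refl
⊑-++⁻ˡ (x ∷ xs) prefix = cong₂ _∷_ (∷-injectiveˡ prefix) (⊑-++⁻ˡ xs (∷-injectiveʳ prefix))

⊑-drop : ∀ {f : ℕ → A} k {xs} → xs ⊑ f → drop k xs ⊑ (λ j → f (k + j))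
⊑-drop zero    prefix = prefix
⊑-drop (suc k) {[]}     prefix = refl
⊑-drop (suc k) {x ∷ xs} prefix = ⊑-drop k (∷-injectiveʳ prefix)

⊑-fromLookup : ∀ {f : ℕ → A} xs → (∀ j (j<n : j < length xs) → f j ≡ lookup xs (fromℕ< j<n)) → xs ⊑ f
⊑-fromLookup []       agree = refl
⊑-fromLookup (x ∷ xs) agree =
  cong₂ _∷_ (agree 0 (s≤s z≤n)) (⊑-fromLookup xs (λ j j<n → agree (suc j) (s≤s j<n)))

posS-⊑ : ∀ M v {f xs} → xs ⊑ f → posS M v f (length xs) ≡ posL M v xs
posS-⊑ M v {f} {xs} prefix = trans (posS≡posL-applyUpTo M v f (length xs)) (cong (posL M v) prefix)

drop-++ : ∀ k (xs : List A) {ys} → k ≤ length xs → drop k (xs ++ ys) ≡ drop k xs ++ ys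
drop-++ zero    xs       k≤n       = refl
drop-++ (suc k) (x ∷ xs) (s≤s k≤n) = drop-++ k xs k≤n

length-drop-≥ : ∀ k n (xs : List A) → k + n ≤ length xs → n ≤ length (drop k xs)
length-drop-≥ k n xs k+n≤ = begin
  n                  ≡⟨ m+n∸m≡n k n ⟨
  k + n ∸ k          ≤⟨ ∸-monoˡ-≤ k k+n≤ ⟩
  length xs ∸ k      ≡⟨ length-drop k xs ⟨
  length (drop k xs) ∎
  where open ≤-Reasoning

lookup-prefix : ∀ {zs xs : List A} ys → zs ≡ xs ++ ys → ∀ {j} (p : j < length xs) (q : j < length zs) →
  lookup zs (fromℕ< q) ≡ lookup xs (fromℕ< p)
lookup-prefix {xs = x ∷ xs} ys refl {zero}  p q = refl
lookup-prefix {xs = x ∷ xs} ys refl {suc j} p q = lookup-prefix {xs = xs} ys refl (s<s⁻¹ p) (s<s⁻¹ q)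

⊑-visits : ∀ {M d v f} u w → u ++ w ⊑ f → VisitsL M d (posL M v u) w →
  Σ ℕ λ t → length u ≤ t × posS M v f t ≡ d
⊑-visits {M} {d} {v} {f} u w prefix visits with visits⇒prefix visits
... | ys , zs , refl , reached =
  length (u ++ ys) , subst (length u ≤_) (sym (length-++ u)) (m≤m+n _ _) , (begin
    posS M v f (length (u ++ ys)) ≡⟨ posS-⊑ M v (⊑-++⁻ˡ (u ++ ys) (subst (_⊑ f) (sym (++-assoc u ys zs)) prefix)) ⟩
    posL M v (u ++ ys)            ≡⟨ posL-++ M v u ys ⟩
    posL M (posL M v u) ys        ≡⟨ reached ⟩
    d                             ∎)
  where open ≡-Reasoning

length-++-∷ : ∀ (xs : List A) {y ys} → suc (length xs) ≤ length (xs ++ y ∷ ys)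
length-++-∷ []       = s≤s z≤n
length-++-∷ (x ∷ xs) = s≤s (length-++-∷ xs)

module Limit (W : ℕ → List A) (W-grows : ∀ s → Σ A λ x → Σ (List A) λ r → W (suc s) ≡ W s ++ x ∷ r) where

  W-long : ∀ s → s ≤ length (W s)
  W-long zero    = z≤n
  W-long (suc s) with W-grows s
  ... | x , r , eq rewrite eq = ≤-trans (s≤s (W-long s)) (length-++-∷ (W s))

  limit : ℕ → A
  limit j = lookup (W (suc j)) (fromℕ< (W-long (suc j)))

  W-prefix : ∀ {s s′} → s ≤′ s′ → Σ (List A) λ r → W s′ ≡ W s ++ r
  W-prefix {s} ≤′-refl = [] , sym (++-identityʳ (W s))
  W-prefix {s} (≤′-step {s′} s≤s′) with W-prefix s≤s′ | W-grows s′
  ... | r , eq | x , r′ , eq′ = r ++ x ∷ r′ , (begin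
    W (suc s′)           ≡⟨ eq′ ⟩
    W s′ ++ x ∷ r′       ≡⟨ cong (_++ x ∷ r′) eq ⟩
    (W s ++ r) ++ x ∷ r′ ≡⟨ ++-assoc (W s) r (x ∷ r′) ⟩
    W s ++ r ++ x ∷ r′   ∎)
    where open ≡-Reasoning

  limit-lookup : ∀ s j (p : j < length (W s)) → limit j ≡ lookup (W s) (fromℕ< p)
  limit-lookup s j p with ≤-total (suc j) s
  ... | inj₁ j<s = let r , eq = W-prefix (≤⇒≤′ j<s) in sym (lookup-prefix r eq (W-long (suc j)) p)
  ... | inj₂ s≤j = let r , eq = W-prefix (≤⇒≤′ s≤j) in lookup-prefix r eq p (W-long (suc j))

  W-⊑ : ∀ s → W s ⊑ limit
  W-⊑ s = ⊑-fromLookup (W s) (limit-lookup s)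

-- Uniform solutions from compactness

RelocationClosed : MazeSet → Set
RelocationClosed 𝒜 = ∀ M o d o′ d′ → 𝒜 M o d → Reach M o o′ → Reach M o d′ → 𝒜 M o′ d′

CompactOnPaths : MazeSet → Set₁
CompactOnPaths 𝒜 = ∀ o d (P : List Dir) → IsPath o d P → IsCompact (λ M → 𝒜 M o d × PathIn M o P)

UniformlySolvable : MazeSet → Set
UniformlySolvable 𝒜 = ∀ o P u → Σ (List Dir) λ w →
  ∀ M → 𝒜 M o (walkEnd o P) → PathIn M o P → VisitsL M (walkEnd o P) (posL M o u) w

relocate-run : ∀ {𝒜} → IsMazeSet 𝒜 → RelocationClosed 𝒜 → ∀ {M o d} → 𝒜 M o d → ∀ u → 𝒜 M (posL M o u) d
relocate-run reach closed {M} {o} {d} a u = closed M o d (posL M o u) d a (reach-posL M o u) (reach M o d a)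

uniformlySolvable : ∀ {𝒜} → IsMazeSet 𝒜 → RelocationClosed 𝒜 → CompactOnPaths 𝒜 →
  Σ Algorithm (λ alg → SolvesSet alg 𝒜) → UniformlySolvable 𝒜
uniformlySolvable reach closed compact (finite ds , solves) o P u =
  ds , λ M a _ → solves M (posL M o u) (walkEnd o P) (relocate-run reach closed a u)
uniformlySolvable {𝒜} reach closed compact (infinite g , solves) o P u =
  applyUpTo g (max 0 horizons) , visits
  where
  d : V
  d = walkEnd o P

  ReachedBy : ℕ → Board → Set
  ReachedBy T M = Σ ℕ λ t → t ≤ T × posL M o (u ++ applyUpTo g t) ≡ d

  reachedBy-isOpen : ∀ T → IsOpen (ReachedBy T)
  reachedBy-isOpen T M (t , t≤T , reached) =
    let F , stable = posL≡-isOpen o (u ++ applyUpTo g t) d M reached in F , λ M′ agree → t , t≤T , stable M′ agree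

  Q : List Dir
  Q = proj₁ (loopErase o P)

  reachedBy-covers : ∀ M → 𝒜 M o d × PathIn M o Q → Σ ℕ λ T → ReachedBy T M
  reachedBy-covers M (a , _) =
    let t , reached = solves M (posL M o u) d (relocate-run reach closed a u)
    in t , t , ≤-refl , (begin
      posL M o (u ++ applyUpTo g t)          ≡⟨ posL-++ M o u (applyUpTo g t) ⟩
      posL M (posL M o u) (applyUpTo g t)    ≡⟨ posS≡posL-applyUpTo M (posL M o u) g t ⟨
      posS M (posL M o u) g t                ≡⟨ reached ⟩
      d                                      ∎)
    where open ≡-Reasoning

  subcover : Σ (List ℕ) λ Ts → ∀ M → 𝒜 M o d × PathIn M o Q → Σ ℕ λ T → T ∈ Ts × ReachedBy T M
  subcover = compact o d Q (proj₁ (proj₂ (loopErase o P))) ℕ ReachedBy reachedBy-isOpen reachedBy-covers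

  horizons : List ℕ
  horizons = proj₁ subcover

  visits : ∀ M → 𝒜 M o d → PathIn M o P → VisitsL M d (posL M o u) (applyUpTo g (max 0 horizons))
  visits M a P⊆M with proj₂ subcover M (a , anti-mono (proj₂ (proj₂ (loopErase o P))) P⊆M)
  ... | T , T∈ , t , t≤T , reached =
    visits-applyUpTo g (≤-trans t≤T (All.lookup (xs≤max 0 horizons) T∈))
      (trans (sym (posL-++ M o u (applyUpTo g t))) reached)

-- Solving a countable union infinitely often

⋃ : {I : Set} → (I → MazeSet) → MazeSet
⋃ {I} 𝒜 M o d = Σ I λ i → 𝒜 i M o d

-- The task (i , o , P , k , n) asks that, on every maze of 𝒜 i from o to the end of P containing P,
-- the robot following the constructed algorithm with its first k instructions dropped be at the end
-- of P at some time ≥ n.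
Task : Set → Set
Task I = I × V × List Dir × ℕ × ℕ

tasks : {I : Set} → ℕ ↠ I → ℕ ↠ Task I
tasks e = e ⊗ (ℕ↠ℤ ⊗ ℕ↠ℤ) ⊗ ℕ↠List ℕ↠Dir ⊗ ↠-id ℕ ⊗ ↠-id ℕ

-- Long enough that dropping k instructions still leaves n, and nonempty so that the stages grow.
padding : ℕ → ℕ → List Dir
padding k n = replicate (suc (k + n)) N

length-padded : ∀ xs k n → k + n ≤ length (xs ++ padding k n)
length-padded xs k n = begin
  k + n                              ≤⟨ m≤n+m (k + n) (suc (length xs)) ⟩
  suc (length xs) + (k + n)          ≡⟨ +-suc (length xs) (k + n) ⟨
  length xs + suc (k + n)            ≡⟨ cong (λ m → length xs + m) (length-replicate (suc (k + n))) ⟨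
  length xs + length (padding k n)   ≡⟨ length-++ xs ⟨
  length (xs ++ padding k n)         ∎
  where open ≤-Reasoning

module Construction {I : Set} (𝒜 : I → MazeSet) (solve : ∀ i → UniformlySolvable (𝒜 i)) (enum : ℕ ↠ Task I) where

  word : I → V → List Dir → List Dir → List Dir
  word i o P u = proj₁ (solve i o P u)

  extension : List Dir → Task I → List Dir
  extension w (i , o , P , k , n) = padding k n ++ word i o P (drop k (w ++ padding k n))

  stages : ℕ → List Dir
  stages zero    = []
  stages (suc s) = stages s ++ extension (stages s) (to enum s)

  open Limit stages (λ s → N , _ , refl) public using (limit; W-⊑)

  stage-visits : ∀ s {i o P k n} → to enum s ≡ (i , o , P , k , n) →
    ∀ M → 𝒜 i M o (walkEnd o P) → PathIn M o P → Σ ℕ λ t → n ≤ t × posS M o (dropS k limit) t ≡ walkEnd o P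
  stage-visits s {i} {o} {P} {k} {n} refl M a P⊆M =
    let t , u≤t , reached = ⊑-visits u w prefix (proj₂ (solve i o P u) M a P⊆M)
    in t , ≤-trans (length-drop-≥ k n _ (length-padded (stages s) k n)) u≤t , reached
    where
    u w : List Dir
    u = drop k (stages s ++ padding k n)
    w = word i o P u

    prefix : u ++ w ⊑ dropS k limit
    prefix = subst (_⊑ dropS k limit)
      (trans (cong (drop k) (sym (++-assoc (stages s) (padding k n) w)))
             (drop-++ k (stages s ++ padding k n) (≤-trans (m≤m+n k n) (length-padded (stages s) k n))))
      (⊑-drop k (W-⊑ (suc s)))

⋃-solvableInfinitelyOften : {I : Set} → ℕ ↠ I → (𝒜 : I → MazeSet) → (∀ i → IsMazeSet (𝒜 i)) →
  (∀ i → UniformlySolvable (𝒜 i)) → Σ (ℕ → Dir) λ A → ∀ k → SolvesInfOften (dropS k A) (⋃ 𝒜)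
⋃-solvableInfinitelyOften e 𝒜 reach solve = limit , infOften
  where
  open Construction 𝒜 solve (tasks e)

  infOften : ∀ k → SolvesInfOften (dropS k limit) (⋃ 𝒜)
  infOften k M o d (i , a) n with reach⇒walk (reach i M o d a)
  ... | P , refl , P⊆M =
    let s , enum-s = strictlySurjective (tasks e) (i , o , P , k , n) in stage-visits s enum-s M a P⊆M

applyUpTo-prependS : ∀ L f t → applyUpTo (prependS L f) (length L + t) ≡ L ++ applyUpTo f t
applyUpTo-prependS []      f t = refl
applyUpTo-prependS (I ∷ L) f t = cong (I ∷_) (applyUpTo-prependS L f t)

posS-prependS : ∀ M v L f t → posS M v (prependS L f) (length L + t) ≡ posS M (posL M v L) f t
posS-prependS M v L f t = begin
  posS M v (prependS L f) (length L + t)            ≡⟨ posS≡posL-applyUpTo M v (prependS L f) (length L + t) ⟩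
  posL M v (applyUpTo (prependS L f) (length L + t)) ≡⟨ cong (posL M v) (applyUpTo-prependS L f t) ⟩
  posL M v (L ++ applyUpTo f t)                     ≡⟨ posL-++ M v L (applyUpTo f t) ⟩
  posL M (posL M v L) (applyUpTo f t)               ≡⟨ posS≡posL-applyUpTo M (posL M v L) f t ⟨
  posS M (posL M v L) f t                           ∎
  where open ≡-Reasoning

solvesInfOften-prependS : ∀ {𝒜 A} → IsMazeSet 𝒜 → RelocationClosed 𝒜 → SolvesInfOften A 𝒜 →
  ∀ L → SolvesInfOften (prependS L A) 𝒜
solvesInfOften-prependS {A = A} reach closed infOften L M o d a n
  with infOften M (posL M o L) d (relocate-run reach closed a L) n
... | t , n≤t , reached = length L + t , ≤-trans n≤t (m≤n+m t (length L)) , trans (posS-prependS M o L A t) reached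

∪-isMazeSet : ∀ {𝒜₁ 𝒜₂} → IsMazeSet 𝒜₁ → IsMazeSet 𝒜₂ → IsMazeSet (𝒜₁ ∪ 𝒜₂)
∪-isMazeSet reach₁ reach₂ M o d (inj₁ a) = reach₁ M o d a
∪-isMazeSet reach₁ reach₂ M o d (inj₂ a) = reach₂ M o d a

∪-relocationClosed : ∀ {𝒜₁ 𝒜₂} → RelocationClosed 𝒜₁ → RelocationClosed 𝒜₂ → RelocationClosed (𝒜₁ ∪ 𝒜₂)
∪-relocationClosed closed₁ closed₂ M o d o′ d′ (inj₁ a) = inj₁ ∘₂ closed₁ M o d o′ d′ a
∪-relocationClosed closed₁ closed₂ M o d o′ d′ (inj₂ a) = inj₂ ∘₂ closed₂ M o d o′ d′ a

∪⊆⋃ : ∀ {𝒜₁ 𝒜₂ M o d} → (𝒜₁ ∪ 𝒜₂) M o d → ⋃ (λ b → if b then 𝒜₁ else 𝒜₂) M o d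
∪⊆⋃ (inj₁ a) = true , a
∪⊆⋃ (inj₂ a) = false , a

proposition3p3 : (𝒜₁ 𝒜₂ : MazeSet) →
    IsMazeSet 𝒜₁ → IsMazeSet 𝒜₂ →
    -- (1) compactness, for i = 1, 2
    (∀ o d (P : List Dir) → IsPath o d P →
       IsCompact (λ M → 𝒜₁ M o d × PathIn M o P)) →
    (∀ o d (P : List Dir) → IsPath o d P →
       IsCompact (λ M → 𝒜₂ M o d × PathIn M o P)) →
    -- (2) closure under changing origin/destination within the component
    (∀ M o d o' d' → 𝒜₁ M o d → Reach M o o' → Reach M o d' → 𝒜₁ M o' d') →
    (∀ M o d o' d' → 𝒜₂ M o d → Reach M o o' → Reach M o d' → 𝒜₂ M o' d') →
    -- (3) solvability
    Σ Algorithm (λ A₁ → SolvesSet A₁ 𝒜₁) →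
    Σ Algorithm (λ A₂ → SolvesSet A₂ 𝒜₂) →
    Σ (ℕ → Dir) λ A →
      SolvesSet (infinite A) (𝒜₁ ∪ 𝒜₂) ×
      SolvesInfOften A (𝒜₁ ∪ 𝒜₂) ×
      (∀ (k : ℕ) → SolvesInfOften (dropS k A) (𝒜₁ ∪ 𝒜₂)) ×
      (∀ (L : List Dir) → SolvesInfOften (prependS L A) (𝒜₁ ∪ 𝒜₂))
proposition3p3 𝒜₁ 𝒜₂ reach₁ reach₂ compact₁ compact₂ closed₁ closed₂ solver₁ solver₂ =
  stream , solves , dropped 0 , dropped , prepended
  where
  𝒜 : Bool → MazeSet
  𝒜 b = if b then 𝒜₁ else 𝒜₂

  reach : ∀ b → IsMazeSet (𝒜 b)
  reach true  = reach₁
  reach false = reach₂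

  uniform : ∀ b → UniformlySolvable (𝒜 b)
  uniform true  = uniformlySolvable reach₁ closed₁ compact₁ solver₁
  uniform false = uniformlySolvable reach₂ closed₂ compact₂ solver₂

  stream : ℕ → Dir
  stream = proj₁ (⋃-solvableInfinitelyOften ℕ↠Bool 𝒜 reach uniform)

  dropped : ∀ k → SolvesInfOften (dropS k stream) (𝒜₁ ∪ 𝒜₂)
  dropped k M o d a = proj₂ (⋃-solvableInfinitelyOften ℕ↠Bool 𝒜 reach uniform) k M o d (∪⊆⋃ a)

  solves : SolvesSet (infinite stream) (𝒜₁ ∪ 𝒜₂)
  solves M o d a = let t , _ , reached = dropped 0 M o d a 0 in t , reached

  prepended : ∀ L → SolvesInfOften (prependS L stream) (𝒜₁ ∪ 𝒜₂)
  prepended = solvesInfOften-prependS (∪-isMazeSet reach₁ reach₂) (∪-relocationClosed closed₁ closed₂) (dropped 0)
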